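{- Let $H$ be a maximal plane graph and $f$ a face of $H$ whose boundary vertices are labelled $x,y,z$, and let $k$ be an integer. If $(k+1)_x^{y,z}$ is nonempty, then $(k)_x$ is empty.
   Context: $H$ is a maximal plane graph (every face bounded by a triangle); $d$ is shortest-path distance in $H$. $\mathrm{qcc}_H(S)=\{u\in V(H): \forall v\in V(H)\ \exists s\in S \text{ with } d(u,s)\geq d(v,s)\}$, and $Q:=\mathrm{qcc}_H(\{x,y,z\})$. For an integer $k$ and disjoint $A,B\subseteq\{x,y,z\}$, $(k)_A^B$ denotes the set of $u\in Q$ with $\min_{t\in\{x,y,z\}}d(u,t)=k$, $d(u,t)=k$ for all $t\in A$ and $d(u,t)=k+1$ for all $t\in B$ (an empty $A$ or $B$ is omitted; e.g. $(k)_x$: $\min_t d(u,t)=k=d(u,x)$; $(k+1)_x^{y,z}$: $d(u,x)=k+1$, $d(u,y)=d(u,z)=k+2$). -}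

module Defs where

open import Data.Nat using (ℕ; zero; suc; _+_; _≤_)
open import Data.Integer as ℤ using (ℤ; +_)
open import Data.Fin using (Fin; zero; suc)
open import Data.Bool using (Bool; true)
open import Data.Product using (Σ; ∃; _×_; _,_)
open import Data.Sum using (_⊎_)
open import Relation.Binary.PropositionalEquality using (_≡_; _≢_)

iter : {A : Set} → (A → A) → ℕ → A → A
iter g zero    a = a
iter g (suc i) a = g (iter g i a)

data Walk {n : ℕ} (Adj : Fin n → Fin n → Set) : Fin n → Fin n → ℕ → Set where
  here : ∀ {u} → Walk Adj u u zero
  step : ∀ {u v w k} → Adj u v → Walk Adj v w k → Walk Adj u w (suc k)

-- A maximal plane graph (plane triangulation), given combinatorially as a
-- rotation system (combinatorial map) of genus 0:
--   darts Fin m, α = fixed-point-free involution (the two half-edges of an edge),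
--   σ = permutation (rotation around vertices), φ = σ ∘ α (face traversal).
--   Vertices/edges/faces are the orbits of σ / α / φ, labelled by
--   vert / edge / face (surjective, constant on orbits, fibres = orbits).
--   Connected + Euler's formula V - E + F = 2  <=> cellular embedding in the sphere.
record MaximalPlaneGraph : Set₁ where
  field
    n m ne nf : ℕ
    α σ σ⁻¹ : Fin m → Fin m
    α-invol  : ∀ d → α (α d) ≡ d
    α-nofix  : ∀ d → α d ≢ d
    σ-inverseˡ : ∀ d → σ⁻¹ (σ d) ≡ d
    σ-inverseʳ : ∀ d → σ (σ⁻¹ d) ≡ d

  φ : Fin m → Fin m
  φ d = σ (α d)

  field
    vert : Fin m → Fin n
    vert-σ : ∀ d → vert (σ d) ≡ vert d
    vert-orbit : ∀ d d' → vert d ≡ vert d' → ∃ λ i → iter σ i d ≡ d'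
    vert-surj : ∀ v → ∃ λ d → vert d ≡ v

    edge : Fin m → Fin ne
    edge-α : ∀ d → edge (α d) ≡ edge d
    edge-orbit : ∀ d d' → edge d ≡ edge d' → ∃ λ i → iter α i d ≡ d'
    edge-surj : ∀ e → ∃ λ d → edge d ≡ e

    face : Fin m → Fin nf
    face-φ : ∀ d → face (φ d) ≡ face d
    face-orbit : ∀ d d' → face d ≡ face d' → ∃ λ i → iter φ i d ≡ d'
    face-surj : ∀ f → ∃ λ d → face d ≡ f

    face-triangle : ∀ d → φ (φ (φ d)) ≡ d
    face-nontrivial : ∀ d → φ d ≢ d

    no-loop : ∀ d → vert (α d) ≢ vert d
    no-multi : ∀ d d' → vert d ≡ vert d' → vert (α d) ≡ vert (α d') → d ≡ d'

  Adj : Fin n → Fin n → Set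
  Adj u v = ∃ λ d → vert d ≡ u × vert (α d) ≡ v

  field
    connected : ∀ u v → ∃ λ k → Walk Adj u v k
    euler : n + nf ≡ ne + 2

  Vertex : Set
  Vertex = Fin n

  Dist : Vertex → Vertex → ℕ → Set
  Dist u v k = Walk Adj u v k × (∀ j → Walk Adj u v j → k ≤ j)

  InQcc : (Fin 3 → Vertex) → Vertex → Set
  InQcc T u = ∀ v → ∃ λ i → ∀ a b → Dist u (T i) a → Dist v (T i) b → b ≤ a

  IsFace : Vertex → Vertex → Vertex → Set
  IsFace x y z = ∃ λ d → vert d ≡ x ×
    ((vert (φ d) ≡ y × vert (φ (φ d)) ≡ z) ⊎ (vert (φ d) ≡ z × vert (φ (φ d)) ≡ y))

  -- u ∈ (k)_A^B with respect to Q = qcc({T 0, T 1, T 2}); A, B ⊆ Fin 3 as Bool predicates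
  InLayer : (Fin 3 → Vertex) → ℤ → (Fin 3 → Bool) → (Fin 3 → Bool) → Vertex → Set
  InLayer T k A B u =
    InQcc T u ×
    Σ (Fin 3 → ℕ) λ δ →
      (∀ i → Dist u (T i) (δ i)) ×
      (∀ i → k ℤ.≤ + δ i) × (∃ λ i → + δ i ≡ k) ×
      (∀ i → A i ≡ true → + δ i ≡ k) ×
      (∀ i → B i ≡ true → + δ i ≡ k ℤ.+ + 1)

terminals : {V : Set} → V → V → V → Fin 3 → V
terminals x y z zero = x
terminals x y z (suc zero) = y
terminals x y z (suc (suc zero)) = z

onlyX : Fin 3 → Bool
onlyX zero = true
onlyX _ = Data.Bool.false

yz : Fin 3 → Bool
yz zero = Data.Bool.false
yz _ = true

none : Fin 3 → Bool
none _ = Data.Bool.false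

-- A vertex w of qcc({x,y,z}) cannot be strictly closer than another vertex u
-- to all three terminals.  If d(w,x) = k, then w is strictly closer than u to x
-- (d(u,x) = k+1), and, since y and z are neighbours of x on the face,
-- d(w,y), d(w,z) ≤ k+1 < k+2 = d(u,y) = d(u,z).
module Submission where

open import Defs
open import Data.Integer using (ℤ; _+_; +_)
open import Data.Integer.Properties using (+-injective)
open import Data.Fin using (Fin; zero; suc)
open import Data.Nat as ℕ using (ℕ; suc; _≤_; _<_; s≤s)
open import Data.Nat.Properties using (+-comm; ≤-refl; <⇒≱)
open import Data.Product using (∃; _×_; _,_; proj₁; proj₂)
open import Data.Sum using (inj₁; inj₂)
open import Relation.Nullary using (¬_)
open import Relation.Binary.PropositionalEquality using (_≡_; refl; sym; trans; cong; subst)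
open Relation.Binary.PropositionalEquality.≡-Reasoning

_∷ʳ_ : ∀ {n} {Adj : Fin n → Fin n → Set} {a b c k} →
       Walk Adj a b k → Adj b c → Walk Adj a c (suc k)
here       ∷ʳ e′ = step e′ here
step e w   ∷ʳ e′ = step e (w ∷ʳ e′)

pos-suc : ∀ {a b k} → + a ≡ k → + b ≡ k + + 1 → b ≡ suc a
pos-suc {a} {b} {k} a≡k b≡k+1 = +-injective (begin
  + b                ≡⟨ b≡k+1 ⟩
  k + + 1            ≡⟨ cong (_+ + 1) (sym a≡k) ⟩
  + (a ℕ.+ 1)        ≡⟨ cong +_ (+-comm a 1) ⟩
  + suc a            ∎)

module _ (H : MaximalPlaneGraph) where
  open MaximalPlaneGraph H

  Adj-sym : ∀ {a b} → Adj a b → Adj b a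
  Adj-sym (d , refl , q) = α d , q , cong vert (α-invol d)

  Adj-φ : ∀ d → Adj (vert d) (vert (φ d))
  Adj-φ d = d , refl , sym (vert-σ (α d))

  Adj-φ² : ∀ d → Adj (vert d) (vert (φ (φ d)))
  Adj-φ² d = Adj-sym (φ (φ d) , refl ,
    trans (sym (vert-σ (α (φ (φ d))))) (cong vert (face-triangle d)))

  IsFace⇒Adj : ∀ {x y z} → IsFace x y z → Adj x y × Adj x z
  IsFace⇒Adj (d , refl , inj₁ (refl , refl)) = Adj-φ d , Adj-φ² d
  IsFace⇒Adj (d , refl , inj₂ (refl , refl)) = Adj-φ² d , Adj-φ d

  Dist-Adj-≤ : ∀ {w a b i j} → Dist w a i → Adj a b → Dist w b j → j ≤ suc i
  Dist-Adj-≤ (walk , _) e (_ , minimal) = minimal _ (walk ∷ʳ e)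

  InQcc⇒¬strictlyCloser : ∀ {T w v} {δw δv : Fin 3 → ℕ} → InQcc T w →
    (∀ i → Dist w (T i) (δw i)) → (∀ i → Dist v (T i) (δv i)) →
    ¬ (∀ i → δw i < δv i)
  InQcc⇒¬strictlyCloser {v = v} w∈Q dw dv closer
    with w∈Q v
  ... | i , farther = <⇒≱ (closer i) (farther _ _ (dw i) (dv i))

lemma13 : (H : MaximalPlaneGraph) → let open MaximalPlaneGraph H in
    (x y z : Vertex) → IsFace x y z → (k : ℤ) →
    ∃ (InLayer (terminals x y z) (k + + 1) onlyX yz) →
    ¬ ∃ (InLayer (terminals x y z) k onlyX none)
lemma13 H x y z face k (u , _ , δu , du , _ , _ , Au , Bu) (w , w∈Q , δw , dw , _ , _ , Aw , _) =
  InQcc⇒¬strictlyCloser H w∈Q dw du closer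
  where
  open MaximalPlaneGraph H using (Adj; Dist)

  δu-x : δu zero ≡ suc (δw zero)
  δu-x = pos-suc (Aw zero refl) (Au zero refl)

  δu-yz : ∀ i → δu (suc i) ≡ suc (suc (δw zero))
  δu-yz i = trans (pos-suc (Au zero refl) (Bu (suc i) refl)) (cong suc δu-x)

  neighbour-closer : ∀ {i t} → Adj x t → Dist w t (δw (suc i)) → δw (suc i) < δu (suc i)
  neighbour-closer {i} e dt = subst (δw (suc i) <_) (sym (δu-yz i)) (s≤s (Dist-Adj-≤ H (dw zero) e dt))

  closer : ∀ i → δw i < δu i
  closer zero             = subst (δw zero <_) (sym δu-x) ≤-refl
  closer (suc zero)       = neighbour-closer (proj₁ (IsFace⇒Adj H face)) (dw (suc zero))
  closer (suc (suc zero)) = neighbour-closer (proj₂ (IsFace⇒Adj H face)) (dw (suc (suc zero)))
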